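{- Assume the following statement (H) holds: for every integer $\ell\ge 1$, every $n$ with $2^n\ge\ell$, and every set $S\subseteq\mathbb{F}_2^n$ of $\ell$ cards that is not contained in any complete set of $2^{\lceil\log_2\ell\rceil}$ cards of $\mathbb{F}_2^n$, the number of quads in $S$ is at most $Q(\ell-1)$. Then for every $\ell\ge 1$ there exists an $\ell$-packed set that is contained in a complete set of $2^{\lceil\log_2\ell\rceil}$ cards.
   Context: An EvenQuads deck of size $2^n$ is the set $\mathbb{F}_2^n$; its elements are called cards. A quad is a $4$-element subset $\{a,b,c,d\}$ of the deck with $a+b+c+d=0$. The number of quads in a set of cards is the number of its $4$-element subsets that are quads. A set $S$ of cards is complete if for any three distinct $a,b,c\in S$ the card $a+b+c$ also lies in $S$. For $\ell\ge 0$, $Q(\ell)$ is the maximum, over all $n$ with $2^n\ge\ell$ and all $\ell$-element subsets $S\subseteq\mathbb{F}_2^n$, of the number of quads in $S$. An $\ell$-packed set is a set of $\ell$ cards in some deck $\mathbb{F}_2^n$ containing exactly $Q(\ell)$ quads. -}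

module Defs where

open import Data.Bool using (Bool; false; _xor_)
open import Data.Nat using (ℕ; zero; suc; _≤_; _∸_; _^_)
open import Data.Nat.Logarithm using (⌈log₂_⌉)
open import Data.Vec using (Vec; replicate; zipWith)
open import Data.Vec.Properties using (≡-dec)
open import Data.Bool.Properties using () renaming (_≟_ to _≟B_)
open import Data.List using (List; []; _∷_; map; _++_; length; filter; foldr)
open import Data.List.Relation.Unary.All using (All)
open import Data.List.Relation.Unary.Unique.Propositional using (Unique)
open import Data.List.Membership.Propositional using (_∈_)
open import Data.Product using (Σ; _×_; ∃; ∃-syntax)
open import Relation.Binary.PropositionalEquality using (_≡_; _≢_)
open import Relation.Nullary using (Dec; ¬_)

Card : ℕ → Set
Card n = Vec Bool n

_⊕_ : ∀ {n} → Card n → Card n → Card n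
_⊕_ = zipWith _xor_

𝟘 : ∀ {n} → Card n
𝟘 = replicate _ false

-- A set of cards: a duplicate-free list (order irrelevant).
-- k-element sub-collections of a list (sublists of length k).
choose : ∀ {A : Set} → ℕ → List A → List (List A)
choose zero    xs       = [] ∷ []
choose (suc k) []       = []
choose (suc k) (x ∷ xs) = map (x ∷_) (choose k xs) ++ choose (suc k) xs

sumCards : ∀ {n} → List (Card n) → Card n
sumCards = foldr _⊕_ 𝟘

isZero? : ∀ {n} (v : Card n) → Dec (v ≡ 𝟘)
isZero? v = ≡-dec _≟B_ v 𝟘

quads : ∀ {n} → List (Card n) → ℕ
quads S = length (filter (λ q → isZero? (sumCards q)) (choose 4 S))

IsSet : ∀ {n} → ℕ → List (Card n) → Set
IsSet ℓ S = Unique S × length S ≡ ℓ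

Complete : ∀ {n} → List (Card n) → Set
Complete T = ∀ a b c → a ∈ T → b ∈ T → c ∈ T →
             a ≢ b → a ≢ c → b ≢ c → (a ⊕ b) ⊕ c ∈ T

_⊆_ : ∀ {n} → List (Card n) → List (Card n) → Set
S ⊆ T = All (_∈ T) S

InCompleteOfSize : ∀ {n} → ℕ → List (Card n) → Set
InCompleteOfSize {n} ℓ S =
  ∃[ T ] (IsSet (2 ^ ⌈log₂ ℓ ⌉) T × Complete T × S ⊆ T)

-- IsQ ℓ q : q = Q(ℓ), the maximum number of quads over all ℓ-element sets
-- in all decks F_2^n with 2^n ≥ ℓ.
IsQ : ℕ → ℕ → Set
IsQ ℓ q =
  (∃[ n ] Σ (List (Card n)) λ S → ℓ ≤ 2 ^ n × IsSet ℓ S × quads S ≡ q)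
  × (∀ n (S : List (Card n)) → ℓ ≤ 2 ^ n → IsSet ℓ S → quads S ≤ q)

Packed : ∀ {n} → ℕ → List (Card n) → Set
Packed {n} ℓ S = ℓ ≤ 2 ^ n × IsSet ℓ S × IsQ ℓ (quads S)

HypH : Set
HypH = ∀ (ℓ : ℕ) → 1 ≤ ℓ → ∀ n (S : List (Card n)) → ℓ ≤ 2 ^ n → IsSet ℓ S →
       ¬ InCompleteOfSize ℓ S →
       ∀ q → IsQ (ℓ ∸ 1) q → quads S ≤ q

-- Induction on ℓ, carrying a packed ℓ-set P inside a complete set T of size
-- 2^⌈log₂ ℓ⌉. P grows to an (ℓ+1)-set P′ with at least as many quads that still
-- lies in a complete set of size 2^⌈log₂(ℓ+1)⌉: add a card of T ∖ P, or, if
-- P = T, pass to F₂ⁿ⁺¹ and take {0} × P together with one card of {1} × T,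
-- inside the complete set F₂ × T. Now let B be a packed (ℓ+1)-set. Either B
-- already lies in a complete set of the right size, or by (H) it has at most
-- Q(ℓ) = quads P ≤ quads P′ quads, so that P′ is packed.
--
-- Constructively, Q(ℓ) must be found as a maximum over all decks. Projections
-- F₂ⁿ⁺¹ → F₂ⁿ along suitable cards preserve the size and the quads of an ℓ-set,
-- so every ℓ-set can be moved into the deck of dimension (ℓ+1)⁴, where the
-- maximum, and membership in a complete set, are decided by exhaustive search.
module Submission where

open import Defs
open import Data.Nat using (ℕ; _≤_)
open import Data.List using (List)
open import Data.Product using (Σ; _×_; ∃-syntax)

open import Algebra.Bundles using (CommutativeSemigroup)
import Algebra.Properties.CommutativeSemigroup as CommutativeSemigroupProperties
open import Data.Bool using (true; false; _xor_; if_then_else_)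
open import Data.Bool.Properties using (xor-assoc; xor-comm; xor-identityˡ; xor-identityʳ; xor-same)
open import Data.List using ([]; _∷_; [_]; map; _++_; length; filter; take; cartesianProductWith)
open import Data.List.Extrema.Nat using (argmax; argmax-all; f[xs]≤f[argmax])
open import Data.List.Membership.Propositional using (_∈_; _∉_; find; lose)
open import Data.List.Membership.Propositional.Properties
  using (∈-map⁺; ∈-map⁻; ∈-++⁺ˡ; ∈-++⁺ʳ; ∈-++⁻; ∈-filter⁺)
import Data.List.Membership.DecPropositional as DecMembership
open import Data.List.Properties using (length-map; length-++; length-take; filter-++; map-++; map-∘)
open import Data.List.Relation.Unary.All as All using (All; []; _∷_)
open import Data.List.Relation.Unary.All.Properties using (¬Any⇒All¬; ¬All⇒Any¬; all-filter) renaming (map⁺ to All-map⁺)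
open import Data.List.Relation.Unary.Any as Any using (here; there)
open import Data.List.Relation.Unary.Any.Properties using (cartesianProductWith⁺)
open import Data.List.Relation.Unary.AllPairs using ([]; _∷_)
open import Data.List.Relation.Unary.Unique.Propositional using (Unique)
import Data.List.Relation.Unary.Unique.Propositional.Properties as Unique
import Data.List.Relation.Unary.Unique.DecPropositional as DecUnique
open import Data.Nat using (zero; suc; _+_; _*_; _^_; _⊓_; _<_; _≟_; _≤′_; ≤′-refl; ≤′-step; z≤n; s≤s; ⌊_/2⌋; ⌈_/2⌉)
open import Data.Nat.Properties
open import Data.Nat.Logarithm using (⌈log₂_⌉; ⌈log₂⌉-mono-≤; ⌈log₂2^n⌉≡n)
open import Data.Nat.Logarithm.Core using (⌈log2⌉)
open import Data.Nat.Induction using (<-wellFounded)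
open import Data.Product using (_,_; proj₁; proj₂; ∃)
open import Data.Sum using (_⊎_; inj₁; inj₂)
open import Data.Vec using ([]; _∷_)
open import Data.Vec.Properties using (≡-dec; ∷-injective; ∷-injectiveʳ; zipWith-assoc; zipWith-comm; zipWith-identityˡ; zipWith-identityʳ)
import Data.Bool.Properties as Bool
open import Function using (_∘_; id)
open import Induction.WellFounded using (Acc; acc)
open import Level using (0ℓ)
open import Relation.Binary.PropositionalEquality
  using (_≡_; _≢_; refl; sym; trans; cong; cong₂; subst; subst₂; module ≡-Reasoning)
open import Relation.Binary.PropositionalEquality.Algebra using (isMagma)
open import Relation.Nullary using (Dec; yes; no; ¬_; contradiction)
open import Relation.Nullary.Decidable using (_×-dec_; _→-dec_; ¬?; map′)

_≟ᶜ_ : ∀ {n} (a b : Card n) → Dec (a ≡ b)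
_≟ᶜ_ = ≡-dec Bool._≟_

⊕-comm : ∀ {n} (a b : Card n) → a ⊕ b ≡ b ⊕ a
⊕-comm = zipWith-comm xor-comm

⊕-assoc : ∀ {n} (a b c : Card n) → (a ⊕ b) ⊕ c ≡ a ⊕ (b ⊕ c)
⊕-assoc = zipWith-assoc xor-assoc

⊕-identityˡ : ∀ {n} (a : Card n) → 𝟘 ⊕ a ≡ a
⊕-identityˡ = zipWith-identityˡ xor-identityˡ

⊕-identityʳ : ∀ {n} (a : Card n) → a ⊕ 𝟘 ≡ a
⊕-identityʳ = zipWith-identityʳ xor-identityʳ

⊕-self : ∀ {n} (a : Card n) → a ⊕ a ≡ 𝟘
⊕-self []      = refl
⊕-self (x ∷ a) = cong₂ _∷_ (xor-same x) (⊕-self a)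

⊕-commutativeSemigroup : ℕ → CommutativeSemigroup 0ℓ 0ℓ
⊕-commutativeSemigroup n = record
  { _∙_ = _⊕_ {n}
  ; isCommutativeSemigroup = record
    { isSemigroup = record { isMagma = isMagma _⊕_ ; assoc = ⊕-assoc }
    ; comm = ⊕-comm
    }
  }

module ⊕-Properties {n} = CommutativeSemigroupProperties (⊕-commutativeSemigroup n)

⊕-cancelˡ : ∀ {n} (a b : Card n) → (a ⊕ a) ⊕ b ≡ b
⊕-cancelˡ a b = trans (cong (_⊕ b) (⊕-self a)) (⊕-identityˡ b)

⊕-cancelʳ : ∀ {n} (a b : Card n) → (a ⊕ b) ⊕ b ≡ a
⊕-cancelʳ a b = begin
  (a ⊕ b) ⊕ b ≡⟨ ⊕-assoc a b b ⟩
  a ⊕ (b ⊕ b) ≡⟨ cong (a ⊕_) (⊕-self b) ⟩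
  a ⊕ 𝟘       ≡⟨ ⊕-identityʳ a ⟩
  a           ∎
  where open ≡-Reasoning

⊕≡𝟘⇒≡ : ∀ {n} {a b : Card n} → a ⊕ b ≡ 𝟘 → a ≡ b
⊕≡𝟘⇒≡ {a = a} {b} e = begin
  a           ≡⟨ ⊕-cancelʳ a b ⟨
  (a ⊕ b) ⊕ b ≡⟨ cong (_⊕ b) e ⟩
  𝟘 ⊕ b       ≡⟨ ⊕-identityˡ b ⟩
  b           ∎
  where open ≡-Reasoning

double : ∀ {n} → List (Card n) → List (Card (suc n))
double T = map (false ∷_) T ++ map (true ∷_) T

∈-double⁺ : ∀ {n} {T : List (Card n)} h {w} → w ∈ T → (h ∷ w) ∈ double T
∈-double⁺         false w∈T = ∈-++⁺ˡ (∈-map⁺ (false ∷_) w∈T)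
∈-double⁺ {T = T} true  w∈T = ∈-++⁺ʳ (map (false ∷_) T) (∈-map⁺ (true ∷_) w∈T)

∈-double⁻ : ∀ {n} {T : List (Card n)} {h w} → (h ∷ w) ∈ double T → w ∈ T
∈-double⁻ {T = T} hw∈ with ∈-++⁻ (map (false ∷_) T) hw∈
... | inj₁ p with _ , w∈T , e ← ∈-map⁻ (false ∷_) p = subst (_∈ T) (sym (∷-injectiveʳ e)) w∈T
... | inj₂ p with _ , w∈T , e ← ∈-map⁻ (true ∷_) p = subst (_∈ T) (sym (∷-injectiveʳ e)) w∈T

double-unique : ∀ {n} {T : List (Card n)} → Unique T → Unique (double T)
double-unique {T = T} u = Unique.++⁺ (Unique.map⁺ ∷-injectiveʳ u) (Unique.map⁺ ∷-injectiveʳ u) disjoint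
  where
  disjoint : ∀ {v} → ¬ (v ∈ map (false ∷_) T × v ∈ map (true ∷_) T)
  disjoint (p , q) with ∈-map⁻ (false ∷_) p | ∈-map⁻ (true ∷_) q
  ... | _ , _ , refl | _ , _ , ()

length-double : ∀ {n} (T : List (Card n)) → length (double T) ≡ 2 * length T
length-double T = begin
  length (map (false ∷_) T ++ map (true ∷_) T)        ≡⟨ length-++ (map (false ∷_) T) ⟩
  length (map (false ∷_) T) + length (map (true ∷_) T) ≡⟨ cong₂ _+_ (length-map _ T) (length-map _ T) ⟩
  length T + length T                                  ≡⟨ cong (length T +_) (+-identityʳ (length T)) ⟨
  2 * length T                                         ∎
  where open ≡-Reasoning

allCards : ∀ n → List (Card n)
allCards zero    = [ [] ]
allCards (suc n) = double (allCards n)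

∈-allCards : ∀ {n} (v : Card n) → v ∈ allCards n
∈-allCards []      = here refl
∈-allCards (h ∷ v) = ∈-double⁺ h (∈-allCards v)

allCards-unique : ∀ n → Unique (allCards n)
allCards-unique zero    = [] ∷ []
allCards-unique (suc n) = double-unique (allCards-unique n)

length-allCards : ∀ n → length (allCards n) ≡ 2 ^ n
length-allCards zero    = refl
length-allCards (suc n) = trans (length-double (allCards n)) (cong (2 *_) (length-allCards n))

module _ {A : Set} where

  private
    remove : ∀ {x : A} (ys : List A) → x ∈ ys → List A
    remove (y ∷ ys) (here _)  = ys
    remove (y ∷ ys) (there p) = y ∷ remove ys p

    length-remove : ∀ {x : A} (ys : List A) (p : x ∈ ys) → suc (length (remove ys p)) ≡ length ys
    length-remove (y ∷ ys) (here _)  = refl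
    length-remove (y ∷ ys) (there p) = cong suc (length-remove ys p)

    ∈-remove : ∀ {x z : A} (ys : List A) (p : x ∈ ys) → z ∈ ys → x ≢ z → z ∈ remove ys p
    ∈-remove (y ∷ ys) (here refl) (here refl) x≢z = contradiction refl x≢z
    ∈-remove (y ∷ ys) (here refl) (there q)   x≢z = q
    ∈-remove (y ∷ ys) (there p)   (here e)    x≢z = here e
    ∈-remove (y ∷ ys) (there p)   (there q)   x≢z = there (∈-remove ys p q x≢z)

  pigeonhole : ∀ {xs ys : List A} → Unique xs → All (_∈ ys) xs → length xs ≤ length ys
  pigeonhole {[]}              _          _           = z≤n
  pigeonhole {x ∷ xs} {ys} (x∉xs ∷ u) (x∈ys ∷ xs⊆ys) =
    subst (suc (length xs) ≤_) (length-remove ys x∈ys)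
      (s≤s (pigeonhole u (All.zipWith (λ (x≢z , z∈ys) → ∈-remove ys x∈ys z∈ys x≢z) (x∉xs , xs⊆ys))))

  module _ (_≟_ : (a b : A) → Dec (a ≡ b)) where
    open DecMembership _≟_ using (_∈?_)

    pigeonhole-∉ : ∀ {xs ys : List A} → Unique xs → length ys < length xs → ∃ λ x → x ∈ xs × x ∉ ys
    pigeonhole-∉ {xs} {ys} u ys<xs =
      find (¬All⇒Any¬ (_∈? ys) xs (λ xs⊆ys → <⇒≱ ys<xs (pigeonhole u xs⊆ys)))

length≤2^n : ∀ {n} {S : List (Card n)} → Unique S → length S ≤ 2 ^ n
length≤2^n {n} {S} u =
  subst (length S ≤_) (length-allCards n) (pigeonhole u (All.tabulate (λ {v} _ → ∈-allCards v)))

length-cartesianProductWith : ∀ {A B C : Set} (f : A → B → C) xs ys →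
  length (cartesianProductWith f xs ys) ≡ length xs * length ys
length-cartesianProductWith f []       ys = refl
length-cartesianProductWith f (x ∷ xs) ys = begin
  length (map (f x) ys ++ cartesianProductWith f xs ys)         ≡⟨ length-++ (map (f x) ys) ⟩
  length (map (f x) ys) + length (cartesianProductWith f xs ys) ≡⟨ cong₂ _+_ (length-map (f x) ys) (length-cartesianProductWith f xs ys) ⟩
  length ys + length xs * length ys                             ∎
  where open ≡-Reasoning

module _ {A : Set} where

  tuples : ℕ → List A → List (List A)
  tuples zero    as = [ [] ]
  tuples (suc k) as = cartesianProductWith _∷_ as (tuples k as)

  length-tuples : ∀ k (as : List A) → length (tuples k as) ≡ length as ^ k
  length-tuples zero    as = refl
  length-tuples (suc k) as = trans (length-cartesianProductWith _∷_ as (tuples k as))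
                                   (cong (length as *_) (length-tuples k as))

  ∈-tuples : ∀ {as xs : List A} {k} → All (_∈ as) xs → length xs ≡ k → xs ∈ tuples k as
  ∈-tuples []         refl = here refl
  ∈-tuples (x∈ ∷ xs∈) refl = cartesianProductWith⁺ _∷_ (cong₂ _∷_) x∈ (∈-tuples xs∈ refl)

∈-tuples-allCards : ∀ {n k} {S : List (Card n)} → length S ≡ k → S ∈ tuples k (allCards n)
∈-tuples-allCards = ∈-tuples (All.tabulate (λ {v} _ → ∈-allCards v))

module _ {A B : Set} (f : A → B) where

  choose-map : ∀ k (xs : List A) → choose k (map f xs) ≡ map (map f) (choose k xs)
  choose-map zero    xs       = refl
  choose-map (suc k) []       = refl
  choose-map (suc k) (x ∷ xs) = begin
    map (f x ∷_) (choose k (map f xs)) ++ choose (suc k) (map f xs)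
      ≡⟨ cong₂ _++_ (cong (map (f x ∷_)) (choose-map k xs)) (choose-map (suc k) xs) ⟩
    map (f x ∷_) (map (map f) (choose k xs)) ++ map (map f) (choose (suc k) xs)
      ≡⟨ cong (_++ _) (trans (sym (map-∘ (choose k xs))) (map-∘ (choose k xs))) ⟩
    map (map f) (map (x ∷_) (choose k xs)) ++ map (map f) (choose (suc k) xs)
      ≡⟨ map-++ (map f) (map (x ∷_) (choose k xs)) (choose (suc k) xs) ⟨
    map (map f) (map (x ∷_) (choose k xs) ++ choose (suc k) xs)
      ∎
    where open ≡-Reasoning

module _ {A : Set} where

  ∈-choose⁻ : ∀ k {xs q : List A} → q ∈ choose k xs → All (_∈ xs) q × length q ≡ k
  ∈-choose⁻ zero    (here refl) = [] , refl
  ∈-choose⁻ (suc k) {x ∷ xs} q∈ with ∈-++⁻ (map (x ∷_) (choose k xs)) q∈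
  ... | inj₂ q∈′ with q⊆xs , |q| ← ∈-choose⁻ (suc k) q∈′ = All.map there q⊆xs , |q|
  ... | inj₁ q∈′ with _ , q′∈ , refl ← ∈-map⁻ (x ∷_) q∈′
                 with q′⊆xs , |q′| ← ∈-choose⁻ k q′∈ = here refl ∷ All.map there q′⊆xs , cong suc |q′|

length-filter-map : ∀ {A B : Set} {P : B → Set} {Q : A → Set} (P? : ∀ b → Dec (P b)) (Q? : ∀ a → Dec (Q a))
  (g : A → B) {xs} → All (λ x → (P (g x) → Q x) × (Q x → P (g x))) xs →
  length (filter P? (map g xs)) ≡ length (filter Q? xs)
length-filter-map P? Q? g []                    = refl
length-filter-map P? Q? g {x ∷ xs} ((to , from) ∷ eqs) with P? (g x) | Q? x
... | yes _  | yes _  = cong suc (length-filter-map P? Q? g eqs)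
... | no  _  | no  _  = length-filter-map P? Q? g eqs
... | yes p  | no ¬q  = contradiction (to p) ¬q
... | no ¬p  | yes q  = contradiction (from q) ¬p

IsQuad? : ∀ {n} (q : List (Card n)) → Dec (sumCards q ≡ 𝟘)
IsQuad? q = isZero? (sumCards q)

quads-∷ : ∀ {n} (x : Card n) (S : List (Card n)) → quads S ≤ quads (x ∷ S)
quads-∷ x S = begin
  quads S
    ≤⟨ m≤n+m _ _ ⟩
  length (filter IsQuad? (map (x ∷_) (choose 3 S))) + length (filter IsQuad? (choose 4 S))
    ≡⟨ length-++ (filter IsQuad? (map (x ∷_) (choose 3 S))) ⟨
  length (filter IsQuad? (map (x ∷_) (choose 3 S)) ++ filter IsQuad? (choose 4 S))
    ≡⟨ cong length (filter-++ IsQuad? (map (x ∷_) (choose 3 S)) (choose 4 S)) ⟨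
  quads (x ∷ S)
    ∎
  where open ≤-Reasoning

record IsLinear {n m} (f : Card n → Card m) : Set where
  field
    map-𝟘 : f 𝟘 ≡ 𝟘
    map-⊕ : ∀ a b → f (a ⊕ b) ≡ f a ⊕ f b

  map-sumCards : ∀ q → f (sumCards q) ≡ sumCards (map f q)
  map-sumCards []      = map-𝟘
  map-sumCards (x ∷ q) = trans (map-⊕ x (sumCards q)) (cong (f x ⊕_) (map-sumCards q))

module _ {n m} {f : Card n → Card m} (lin : IsLinear f) where
  open IsLinear lin

  quads-map : ∀ S → (∀ {q} → q ∈ choose 4 S → f (sumCards q) ≡ 𝟘 → sumCards q ≡ 𝟘) →
    quads (map f S) ≡ quads S
  quads-map S reflects = begin
    length (filter IsQuad? (choose 4 (map f S)))        ≡⟨ cong (length ∘ filter IsQuad?) (choose-map f 4 S) ⟩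
    length (filter IsQuad? (map (map f) (choose 4 S)))  ≡⟨ length-filter-map IsQuad? IsQuad? (map f) (All.tabulate equiv) ⟩
    quads S                                             ∎
    where
    open ≡-Reasoning
    equiv : ∀ {q} → q ∈ choose 4 S → (sumCards (map f q) ≡ 𝟘 → sumCards q ≡ 𝟘) × (sumCards q ≡ 𝟘 → sumCards (map f q) ≡ 𝟘)
    equiv {q} q∈ = (λ e → reflects q∈ (trans (map-sumCards q) e))
                 , (λ e → trans (sym (map-sumCards q)) (trans (cong f e) map-𝟘))

map-unique : ∀ {A B : Set} (f : A → B) {S : List A} →
  (∀ {a b} → a ∈ S → b ∈ S → f a ≡ f b → a ≡ b) → Unique S → Unique (map f S)
map-unique f {[]}    inj []         = []
map-unique f {x ∷ S} inj (x∉S ∷ u) =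
  All-map⁺ (All.zipWith (λ (x≢y , y∈S) e → x≢y (inj (here refl) (there y∈S) e)) (x∉S , All.tabulate id))
  ∷ map-unique f (λ a∈ b∈ → inj (there a∈) (there b∈)) u

lift : ∀ {n} → Card n → Card (suc n)
lift = false ∷_

lift-isLinear : ∀ {n} → IsLinear (lift {n})
lift-isLinear = record { map-𝟘 = refl ; map-⊕ = λ _ _ → refl }

-- The linear map F₂ⁿ⁺¹ → F₂ⁿ with kernel {0, v} (for v ≠ 0): the first
-- coordinate i with vᵢ = 1 is dropped after adding v wherever xᵢ = 1.
-- For v = 0 it is junk.
project : ∀ {m} → Card (suc m) → Card (suc m) → Card m
project         (true  ∷ v) (x ∷ xs) = if x then xs ⊕ v else xs
project {zero}  (false ∷ v) _        = []
project {suc m} (false ∷ v) (x ∷ xs) = x ∷ project v xs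

project-isLinear : ∀ {m} (v : Card (suc m)) → IsLinear (project v)
project-isLinear v = record { map-𝟘 = project-𝟘 v ; map-⊕ = project-⊕ v }
  where
  open ⊕-Properties using (xy∙z≈xz∙y; interchange)
  project-𝟘 : ∀ {m} (v : Card (suc m)) → project v 𝟘 ≡ 𝟘
  project-𝟘         (true  ∷ v) = refl
  project-𝟘 {zero}  (false ∷ v) = refl
  project-𝟘 {suc m} (false ∷ v) = cong (false ∷_) (project-𝟘 v)
  project-⊕ : ∀ {m} (v : Card (suc m)) x y → project v (x ⊕ y) ≡ project v x ⊕ project v y
  project-⊕         (true ∷ v) (false ∷ xs) (false ∷ ys) = refl
  project-⊕         (true ∷ v) (false ∷ xs) (true  ∷ ys) = ⊕-assoc xs ys v
  project-⊕         (true ∷ v) (true  ∷ xs) (false ∷ ys) = xy∙z≈xz∙y xs ys v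
  project-⊕         (true ∷ v) (true  ∷ xs) (true  ∷ ys) = begin
    xs ⊕ ys             ≡⟨ ⊕-identityʳ (xs ⊕ ys) ⟨
    (xs ⊕ ys) ⊕ 𝟘       ≡⟨ cong ((xs ⊕ ys) ⊕_) (⊕-self v) ⟨
    (xs ⊕ ys) ⊕ (v ⊕ v) ≡⟨ interchange xs v ys v ⟨
    (xs ⊕ v) ⊕ (ys ⊕ v) ∎
    where open ≡-Reasoning
  project-⊕ {zero}  (false ∷ v) _        _        = refl
  project-⊕ {suc m} (false ∷ v) (x ∷ xs) (y ∷ ys) = cong ((x xor y) ∷_) (project-⊕ v xs ys)

project-kernel : ∀ {m} {v : Card (suc m)} → v ≢ 𝟘 → ∀ x → project v x ≡ 𝟘 → x ≡ 𝟘 ⊎ x ≡ v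
project-kernel {v = true ∷ v} _ (false ∷ xs) e = inj₁ (cong (false ∷_) e)
project-kernel {v = true ∷ v} _ (true  ∷ xs) e = inj₂ (cong (true ∷_) (⊕≡𝟘⇒≡ e))
project-kernel {zero}  {false ∷ []} v≢𝟘 _ _ = contradiction refl v≢𝟘
project-kernel {suc m} {false ∷ v}  v≢𝟘 (x ∷ xs) e with refl , e′ ← ∷-injective e
  with project-kernel (v≢𝟘 ∘ cong (false ∷_)) xs e′
... | inj₁ xs≡𝟘 = inj₁ (cong (false ∷_) xs≡𝟘)
... | inj₂ xs≡v = inj₂ (cong (false ∷_) xs≡v)

Attained : ℕ → ℕ → ℕ → Set
Attained n ℓ q = Σ (List (Card n)) λ S → IsSet ℓ S × quads S ≡ q

attained-lift : ∀ {n ℓ q} → Attained n ℓ q → Attained (suc n) ℓ q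
attained-lift (S , (u , |S|) , qS) =
  map lift S ,
  (map-unique lift (λ _ _ → ∷-injectiveʳ) u , trans (length-map lift S) |S|) ,
  trans (quads-map lift-isLinear S (λ _ → ∷-injectiveʳ)) qS

sumCards-pair : ∀ {n} (a b : Card n) → sumCards (a ∷ b ∷ 𝟘 ∷ 𝟘 ∷ []) ≡ a ⊕ b
sumCards-pair a b =
  cong (a ⊕_) (trans (cong (b ⊕_) (trans (⊕-identityˡ (𝟘 ⊕ 𝟘)) (⊕-self 𝟘))) (⊕-identityʳ b))

-- Projecting along a card v outside all sums of four elements of {0} ∪ S
-- is injective on S (v ≠ a + b) and creates no quads (v ≠ a + b + c + d).
attained-project : ∀ {n ℓ q} → suc ℓ ^ 4 < 2 ^ suc n → Attained (suc n) ℓ q → Attained n ℓ q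
attained-project {n} {ℓ} bound (S , (u , |S|) , qS) =
  map (project v) S ,
  (map-unique (project v) injective u , trans (length-map _ S) |S|) ,
  trans (quads-map (project-isLinear v) S noNewQuad) qS
  where
  sums : List (Card (suc n))
  sums = map sumCards (tuples 4 (𝟘 ∷ S))
  length-sums : length sums ≡ suc ℓ ^ 4
  length-sums = trans (length-map sumCards (tuples 4 (𝟘 ∷ S))) (trans (length-tuples 4 (𝟘 ∷ S)) (cong (λ k → suc k ^ 4) |S|))
  avoiding : ∃ λ v → v ∈ allCards (suc n) × v ∉ sums
  avoiding = pigeonhole-∉ _≟ᶜ_ (allCards-unique (suc n))
               (subst₂ _<_ (sym length-sums) (sym (length-allCards (suc n))) bound)
  v : Card (suc n)
  v = proj₁ avoiding
  v∉sums : v ∉ sums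
  v∉sums = proj₂ (proj₂ avoiding)
  open IsLinear (project-isLinear v) using (map-⊕)
  sum∈sums : ∀ {q} → All (_∈ 𝟘 ∷ S) q → length q ≡ 4 → sumCards q ∈ sums
  sum∈sums q⊆ |q| = ∈-map⁺ sumCards (∈-tuples q⊆ |q|)
  pair∉ : ∀ {a b} → a ∈ 𝟘 ∷ S → b ∈ 𝟘 ∷ S → a ⊕ b ≢ v
  pair∉ {a} {b} a∈ b∈ a⊕b≡v = v∉sums (subst (_∈ sums) (trans (sumCards-pair a b) a⊕b≡v)
                                  (sum∈sums (a∈ ∷ b∈ ∷ here refl ∷ here refl ∷ []) refl))
  v≢𝟘 : v ≢ 𝟘
  v≢𝟘 v≡𝟘 = pair∉ (here refl) (here refl) (trans (⊕-self 𝟘) (sym v≡𝟘))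
  noNewQuad : ∀ {q} → q ∈ choose 4 S → project v (sumCards q) ≡ 𝟘 → sumCards q ≡ 𝟘
  noNewQuad {q} q∈ e with project-kernel v≢𝟘 (sumCards q) e
  ... | inj₁ sum≡𝟘 = sum≡𝟘
  ... | inj₂ sum≡v with q⊆S , |q| ← ∈-choose⁻ 4 q∈ =
    contradiction (subst (_∈ sums) sum≡v (sum∈sums (All.map there q⊆S) |q|)) v∉sums
  injective : ∀ {a b} → a ∈ S → b ∈ S → project v a ≡ project v b → a ≡ b
  injective {a} {b} a∈ b∈ e with project-kernel v≢𝟘 (a ⊕ b) (trans (map-⊕ a b) (trans (cong (_⊕ project v b) e) (⊕-self _)))
  ... | inj₁ a⊕b≡𝟘 = ⊕≡𝟘⇒≡ a⊕b≡𝟘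
  ... | inj₂ a⊕b≡v = contradiction a⊕b≡v (pair∉ (there a∈) (there b∈))

n<2^n : ∀ n → n < 2 ^ n
n<2^n zero    = s≤s z≤n
n<2^n (suc n) = ≤-trans (+-mono-≤ (m^n>0 2 n) (n<2^n n)) (≤-reflexive (cong (2 ^ n +_) (sym (+-identityʳ _))))

attained-up : ∀ {n m ℓ q} → n ≤′ m → Attained n ℓ q → Attained m ℓ q
attained-up ≤′-refl     = id
attained-up (≤′-step p) = attained-lift ∘ attained-up p

attained-down : ∀ {n m ℓ q} → suc ℓ ^ 4 < 2 ^ suc m → m ≤′ n → Attained n ℓ q → Attained m ℓ q
attained-down bound ≤′-refl     = id
attained-down bound (≤′-step p) =
  attained-down bound p ∘ attained-project (<-≤-trans bound (^-monoʳ-≤ 2 (s≤s (≤′⇒≤ p))))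

quadDim : ℕ → ℕ
quadDim ℓ = suc ℓ ^ 4

attained-normalise : ∀ {n ℓ q} → Attained n ℓ q → Attained (quadDim ℓ) ℓ q
attained-normalise {n} {ℓ} with ≤-total n (quadDim ℓ)
... | inj₁ n≤N = attained-up (≤⇒≤′ n≤N)
... | inj₂ N≤n = attained-down (<-≤-trans (n<2^n (quadDim ℓ)) (^-monoʳ-≤ 2 (n≤1+n (quadDim ℓ)))) (≤⇒≤′ N≤n)

packed-exists : ∀ ℓ → ∃[ n ] Σ (List (Card n)) (Packed ℓ)
packed-exists ℓ = N , best , ℓ≤2^N , best-isSet , (N , best , ℓ≤2^N , best-isSet , refl) , best-max
  where
  N : ℕ
  N = quadDim ℓ
  open DecUnique (_≟ᶜ_ {N}) using (unique?)
  isSet? : (S : List (Card N)) → Dec (IsSet ℓ S)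
  isSet? S = unique? S ×-dec (length S ≟ ℓ)
  candidates : List (List (Card N))
  candidates = filter isSet? (tuples ℓ (allCards N))
  ℓ≤2^N : ℓ ≤ 2 ^ N
  ℓ≤2^N = ≤-trans (≤-trans (n≤1+n ℓ) (m≤m*n (suc ℓ) (suc ℓ ^ 3) {{m^n≢0 (suc ℓ) 3}})) (<⇒≤ (n<2^n N))
  initial : List (Card N)
  initial = take ℓ (allCards N)
  initial-isSet : IsSet ℓ initial
  initial-isSet = Unique.take⁺ ℓ (allCards-unique N) ,
    trans (length-take ℓ (allCards N)) (trans (cong (ℓ ⊓_) (length-allCards N)) (m≤n⇒m⊓n≡m ℓ≤2^N))
  best : List (Card N)
  best = argmax quads initial candidates
  best-isSet : IsSet ℓ best
  best-isSet = argmax-all quads initial-isSet (all-filter isSet? (tuples ℓ (allCards N)))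
  best-max : ∀ n (S : List (Card n)) → ℓ ≤ 2 ^ n → IsSet ℓ S → quads S ≤ quads best
  best-max n S _ isS with S′ , isS′ , qS′ ← attained-normalise (S , isS , refl) =
    subst (_≤ quads best) qS′ (All.lookup (f[xs]≤f[argmax] initial candidates) S′∈candidates)
    where
    S′∈candidates : S′ ∈ candidates
    S′∈candidates = ∈-filter⁺ isSet? (∈-tuples-allCards (proj₂ isS′)) isS′

module _ {n : ℕ} where
  open DecMembership (_≟ᶜ_ {n}) using (_∈?_)
  open DecUnique (_≟ᶜ_ {n}) using (unique?)

  complete? : (T : List (Card n)) → Dec (Complete T)
  complete? T = map′
    (λ all a b c a∈ b∈ c∈ → All.lookup (All.lookup (All.lookup all a∈) b∈) c∈)
    (λ cT → All.tabulate λ a∈ → All.tabulate λ b∈ → All.tabulate λ c∈ → cT _ _ _ a∈ b∈ c∈)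
    (All.all? (λ a → All.all? (λ b → All.all? (λ c →
      ¬? (a ≟ᶜ b) →-dec (¬? (a ≟ᶜ c) →-dec (¬? (b ≟ᶜ c) →-dec ((a ⊕ b) ⊕ c ∈? T)))) T) T) T)

  inCompleteOfSize? : ∀ ℓ (S : List (Card n)) → Dec (InCompleteOfSize ℓ S)
  inCompleteOfSize? ℓ S = map′ Any.satisfied
    (λ (_ , witness@((_ , |T|) , _)) → lose (∈-tuples-allCards |T|) witness)
    (Any.any? witness? (tuples (2 ^ ⌈log₂ ℓ ⌉) (allCards n)))
    where
    witness? : ∀ T → Dec (IsSet (2 ^ ⌈log₂ ℓ ⌉) T × Complete T × S ⊆ T)
    witness? T = (unique? T ×-dec (length T ≟ _)) ×-dec (complete? T ×-dec All.all? (_∈? T) S)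

n≤2^⌈log₂n⌉ : ∀ n → n ≤ 2 ^ ⌈log₂ n ⌉
n≤2^⌈log₂n⌉ n = bound n (<-wellFounded n)
  where
  bound : ∀ n (rec : Acc _<_ n) → n ≤ 2 ^ ⌈log2⌉ n rec
  bound zero          _        = z≤n
  bound (suc zero)    _        = s≤s z≤n
  bound (suc (suc n)) (acc rs) = begin
    2 + n                                        ≡⟨ cong (2 +_) (⌊n/2⌋+⌈n/2⌉≡n n) ⟨
    2 + (⌊ n /2⌋ + ⌈ n /2⌉)                      ≤⟨ +-monoʳ-≤ 2 (+-monoˡ-≤ ⌈ n /2⌉ (⌊n/2⌋≤⌈n/2⌉ n)) ⟩
    2 + (⌈ n /2⌉ + ⌈ n /2⌉)                      ≡⟨ cong (λ m → 2 + (⌈ n /2⌉ + m)) (+-identityʳ ⌈ n /2⌉) ⟨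
    2 + 2 * ⌈ n /2⌉                              ≡⟨ *-suc 2 ⌈ n /2⌉ ⟨
    2 * suc ⌈ n /2⌉                              ≤⟨ *-monoʳ-≤ 2 (bound (suc ⌈ n /2⌉) (rs (⌈n/2⌉<n n))) ⟩
    2 * 2 ^ ⌈log2⌉ (suc ⌈ n /2⌉) (rs (⌈n/2⌉<n n)) ∎
    where open ≤-Reasoning

⌈log₂1+n⌉≡⌈log₂n⌉ : ∀ {n} → suc n ≤ 2 ^ ⌈log₂ n ⌉ → ⌈log₂ (suc n) ⌉ ≡ ⌈log₂ n ⌉
⌈log₂1+n⌉≡⌈log₂n⌉ {n} 1+n≤ = ≤-antisym
  (≤-trans (⌈log₂⌉-mono-≤ 1+n≤) (≤-reflexive (⌈log₂2^n⌉≡n ⌈log₂ n ⌉)))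
  (⌈log₂⌉-mono-≤ (n≤1+n n))

⌈log₂1+2^n⌉≡1+n : ∀ n → ⌈log₂ (1 + 2 ^ n) ⌉ ≡ 1 + n
⌈log₂1+2^n⌉≡1+n n = ≤-antisym
  (≤-trans (⌈log₂⌉-mono-≤ 1+2^n≤2^[1+n]) (≤-reflexive (⌈log₂2^n⌉≡n (suc n))))
  (≰⇒> λ ⌈log₂⌉≤n → 1+n≰n (≤-trans (n≤2^⌈log₂n⌉ (1 + 2 ^ n)) (^-monoʳ-≤ 2 ⌈log₂⌉≤n)))
  where
  1+2^n≤2^[1+n] : 1 + 2 ^ n ≤ 2 ^ suc n
  1+2^n≤2^[1+n] = ≤-trans (+-monoˡ-≤ (2 ^ n) (m^n>0 2 n)) (≤-reflexive (cong (2 ^ n +_) (sym (+-identityʳ _))))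

complete⇒closed : ∀ {n} {T : List (Card n)} → Complete T →
  ∀ {a b c} → a ∈ T → b ∈ T → c ∈ T → (a ⊕ b) ⊕ c ∈ T
complete⇒closed {T = T} cT {a} {b} {c} a∈ b∈ c∈ with a ≟ᶜ b
... | yes refl = subst (_∈ T) (sym (⊕-cancelˡ a c)) c∈
... | no a≢b with a ≟ᶜ c
...   | yes refl = subst (_∈ T) (sym (trans (⊕-Properties.xy∙z≈xz∙y a b a) (⊕-cancelˡ a b))) b∈
...   | no a≢c with b ≟ᶜ c
...     | yes refl = subst (_∈ T) (sym (⊕-cancelʳ a b)) a∈
...     | no b≢c   = cT a b c a∈ b∈ c∈ a≢b a≢c b≢c

double-complete : ∀ {n} {T : List (Card n)} → Complete T → Complete (double T)
double-complete cT (_ ∷ _) (_ ∷ _) (_ ∷ _) a∈ b∈ c∈ _ _ _ =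
  ∈-double⁺ _ (complete⇒closed cT (∈-double⁻ a∈) (∈-double⁻ b∈) (∈-double⁻ c∈))

grow-inside : ∀ {n ℓ} {P T : List (Card n)} → IsSet ℓ P → Unique T → P ⊆ T → length P < length T →
  Σ (List (Card n)) λ P′ → IsSet (suc ℓ) P′ × P′ ⊆ T × quads P ≤ quads P′
grow-inside {P = P} (uP , |P|) uT P⊆T |P|<|T| with x , x∈T , x∉P ← pigeonhole-∉ _≟ᶜ_ uT |P|<|T| =
  x ∷ P , (¬Any⇒All¬ P x∉P ∷ uP , cong suc |P|) , x∈T ∷ P⊆T , quads-∷ x P

grow-doubling : ∀ {n ℓ} {P T : List (Card n)} {t} → IsSet ℓ P → t ∈ T → P ⊆ T →
  Σ (List (Card (suc n))) λ P′ → IsSet (suc ℓ) P′ × P′ ⊆ double T × quads P ≤ quads P′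
grow-doubling {P = P} {t = t} (uP , |P|) t∈T P⊆T =
  (true ∷ t) ∷ map lift P ,
  (All-map⁺ (All.tabulate (λ _ ())) ∷ map-unique lift (λ _ _ → ∷-injectiveʳ) uP ,
   cong suc (trans (length-map lift P) |P|)) ,
  ∈-double⁺ true t∈T ∷ All-map⁺ (All.map (∈-double⁺ false) P⊆T) ,
  ≤-trans (≤-reflexive (sym (quads-map lift-isLinear P (λ _ → ∷-injectiveʳ)))) (quads-∷ (true ∷ t) (map lift P))

0<length⇒∃∈ : ∀ {A : Set} {xs : List A} → 0 < length xs → ∃ (_∈ xs)
0<length⇒∃∈ {xs = x ∷ _} _ = x , here refl

grow : ∀ {n ℓ} {P : List (Card n)} → IsSet ℓ P → InCompleteOfSize ℓ P →
  ∃[ m ] Σ (List (Card m)) λ P′ → IsSet (suc ℓ) P′ × InCompleteOfSize (suc ℓ) P′ × quads P ≤ quads P′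
grow {n} {ℓ} isP@(uP , |P|) (T , (uT , |T|) , cT , P⊆T) with m≤n⇒m<n∨m≡n (pigeonhole uP P⊆T)
... | inj₁ |P|<|T| with P′ , isP′ , P′⊆T , more ← grow-inside isP uT P⊆T |P|<|T| =
  n , P′ , isP′ , (T , (uT , trans |T| (cong (2 ^_) (sym same-log))) , cT , P′⊆T) , more
  where
  same-log : ⌈log₂ (suc ℓ) ⌉ ≡ ⌈log₂ ℓ ⌉
  same-log = ⌈log₂1+n⌉≡⌈log₂n⌉ (subst₂ _<_ |P| |T| |P|<|T|)
... | inj₂ |P|≡|T|
  with t , t∈T ← 0<length⇒∃∈ (subst (0 <_) (sym |T|) (m^n>0 2 ⌈log₂ ℓ ⌉))
  with P′ , isP′ , P′⊆ , more ← grow-doubling isP t∈T P⊆T =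
  suc n , P′ , isP′ , (double T , (double-unique uT , length-doubled) , double-complete cT , P′⊆) , more
  where
  j : ℕ
  j = ⌈log₂ ℓ ⌉
  ℓ≡2^j : ℓ ≡ 2 ^ j
  ℓ≡2^j = trans (sym |P|) (trans |P|≡|T| |T|)
  length-doubled : length (double T) ≡ 2 ^ ⌈log₂ (suc ℓ) ⌉
  length-doubled = begin
    length (double T)        ≡⟨ length-double T ⟩
    2 * length T             ≡⟨ cong (2 *_) |T| ⟩
    2 ^ suc j                ≡⟨ cong (2 ^_) (⌈log₂1+2^n⌉≡1+n j) ⟨
    2 ^ ⌈log₂ (1 + 2 ^ j) ⌉  ≡⟨ cong (λ k → 2 ^ ⌈log₂ (suc k) ⌉) ℓ≡2^j ⟨
    2 ^ ⌈log₂ (suc ℓ) ⌉      ∎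
    where open ≡-Reasoning

PackedInComplete : ℕ → Set
PackedInComplete ℓ = ∃[ n ] Σ (List (Card n)) λ S → Packed ℓ S × InCompleteOfSize ℓ S

packed⁺ : ∀ {n ℓ q} {S : List (Card n)} → IsSet ℓ S → IsQ ℓ q → q ≤ quads S → Packed ℓ S
packed⁺ {n} {S = S} isS@(uS , |S|) isQ@(_ , max) q≤ =
  ℓ≤2^n , isS , subst (IsQ _) (≤-antisym q≤ (max n S ℓ≤2^n isS)) isQ
  where
  ℓ≤2^n : _ ≤ 2 ^ n
  ℓ≤2^n = subst (_≤ 2 ^ n) |S| (length≤2^n uS)

singleton-complete : ∀ {n} {T : List (Card n)} → length T ≡ 1 → Complete T
singleton-complete {T = _ ∷ []} _ _ _ _ (here refl) (here refl) _ a≢b _ _ = contradiction refl a≢b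

packedInComplete-1 : PackedInComplete 1
packedInComplete-1 = base (packed-exists 1)
  where
  base : ∃[ n ] Σ (List (Card n)) (Packed 1) → PackedInComplete 1
  base (n , S , packed@(_ , isS@(_ , |S|) , _)) = n , S , packed , S , isS , singleton-complete |S| , All.tabulate id

packedInComplete-suc : ∀ {ℓ} → HypH → PackedInComplete (suc ℓ) → PackedInComplete (suc (suc ℓ))
packedInComplete-suc {ℓ} H (_ , P , (_ , isP , Q[P]) , incP) = step (packed-exists (suc (suc ℓ)))
  where
  step : ∃[ m ] Σ (List (Card m)) (Packed (suc (suc ℓ))) → PackedInComplete (suc (suc ℓ))
  step (m , B , packedB@(B≤2^m , isB , Q[B])) with inCompleteOfSize? (suc (suc ℓ)) B
  ... | yes incB = m , B , packedB , incB
  ... | no ¬incB with m′ , P′ , isP′ , incP′ , P≤P′ ← grow isP incP =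
    m′ , P′ , packed⁺ isP′ Q[B] (≤-trans (H (suc (suc ℓ)) (s≤s z≤n) m B B≤2^m isB ¬incB (quads P) Q[P]) P≤P′) , incP′

mainTheorem6 : HypH → ∀ (ℓ : ℕ) → 1 ≤ ℓ →
    ∃[ n ] Σ (List (Card n)) λ S → Packed ℓ S × InCompleteOfSize ℓ S
mainTheorem6 H (suc ℓ) _ = packedInComplete ℓ
  where
  packedInComplete : ∀ ℓ → PackedInComplete (suc ℓ)
  packedInComplete zero    = packedInComplete-1
  packedInComplete (suc ℓ) = packedInComplete-suc H (packedInComplete ℓ)
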